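{- Let $S=(V,\mathcal{H})$ and $S'=(V,\mathcal{H}')$ be boolean representable simplicial complexes on the same vertex set $V$ with $|V|\leq 4$. Then $S\vee S'=(V,\mathcal{H}\cup\mathcal{H}')$ is boolean representable.
   Context: A (finite) simplicial complex is a pair $S=(V,\mathcal{H})$ where $V$ is a finite nonempty set and $\mathcal{H}\subseteq 2^V$ contains all singletons and is closed under taking subsets. $S$ is boolean representable if there is a boolean matrix $M$ with columns indexed by $V$ such that $\mathcal{H}$ is exactly the set of $X\subseteq V$ for which some square submatrix with column set $X$ is congruent (by permuting rows and columns) to a lower unitriangular boolean matrix. The join of $(V,\mathcal{H})$ and $(V,\mathcal{H}')$ is $(V,\mathcal{H}\cup\mathcal{H}')$. -}

module Defs where

open import Data.Nat using (ℕ)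
open import Data.Bool using (Bool; true; false)
open import Data.Fin using (Fin; _<_)
open import Data.Fin.Subset using (Subset; _∈_; _⊆_; ⁅_⁆)
open import Data.Product using (Σ; ∃; _×_)
open import Function using (_⇔_)
open import Function.Definitions using (Injective)
open import Relation.Binary.PropositionalEquality using (_≡_)

record IsSimplicialComplex {n : ℕ} (H : Subset n → Set) : Set where
  field
    singletons : ∀ (v : Fin n) → H ⁅ v ⁆
    downClosed : ∀ (X Y : Subset n) → Y ⊆ X → H X → H Y

BoolMatrix : ℕ → ℕ → Set
BoolMatrix m n = Fin m → Fin n → Bool

LowerUnitriangularAt : ∀ {m n k : ℕ} → BoolMatrix m n → (Fin k → Fin m) → (Fin k → Fin n) → Set
LowerUnitriangularAt {k = k} M r c =
  (∀ (i : Fin k) → M (r i) (c i) ≡ true) ×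
  (∀ (i j : Fin k) → i < j → M (r i) (c j) ≡ false)

-- X is M-independent: some square submatrix of M with column set X is
-- congruent (by permuting rows and columns) to a lower unitriangular matrix.
-- Permutations are absorbed by the choice of the enumerations r and c.
Independent : ∀ {m n : ℕ} → BoolMatrix m n → Subset n → Set
Independent {m} {n} M X =
  Σ ℕ λ k → Σ (Fin k → Fin m) λ r → Σ (Fin k → Fin n) λ c →
    Injective _≡_ _≡_ r × Injective _≡_ _≡_ c ×
    (∀ (v : Fin n) → (v ∈ X) ⇔ (∃ λ (j : Fin k) → c j ≡ v)) ×
    LowerUnitriangularAt M r c

BooleanRepresentable : ∀ {n : ℕ} → (Subset n → Set) → Set
BooleanRepresentable {n} H =
  Σ ℕ λ m → Σ (BoolMatrix m n) λ M → ∀ (X : Subset n) → H X ⇔ Independent M X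

module Submission where

-- A boolean representable complex has the point replacement property: if X is a nonempty face
-- and p ∉ X, then (X - x) ∪ ⁅ p ⁆ is a face for some x ∈ X. Indeed, let x be the first column of
-- a triangular submatrix on X and r its row; if M r p is 1, exchange x for p, otherwise exchange
-- some later column by induction. Point replacement passes to joins, and the faces of a
-- representable complex are decidable.
--
-- Conversely, a decidable complex is represented by its flat matrix, whose rows are the
-- complements of its flats, as soon as every nonempty face X has a vertex x and a flat containing
-- X - x but not x. On at most four vertices a nonempty face is a vertex, an edge {a, b}, or misses
-- at most one vertex, and point replacement supplies the flat in each case: ∅; b together with the
-- vertices not adjacent to b; X - y, where y is exchanged against the missing vertex.

open import Defs
open import Data.Nat using (ℕ; zero; suc; _≤_; s≤s; z≤n)
open import Data.Fin.Subset
  using (Subset; _∈_; _∉_; _⊆_; _⊂_; _∪_; _-_; ⁅_⁆; ⊥; Nonempty; Empty; inside; outside)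
open import Data.Sum as Sum using (_⊎_; inj₁; inj₂; [_,_]′)

open import Data.Bool using (true; false; not)
open import Data.Bool.Properties using (not-injective; ¬-not) renaming (_≟_ to _≟ᵇ_)
open import Data.Empty using (⊥-elim)
open import Data.Fin using (Fin; zero; suc; fromℕ<; _<_)
open import Data.Fin.Properties using (any?; all?; suc-injective; <-cmp; _≟_)
open import Data.Fin.Subset.Properties
  using (_∈?_; _⊆?_; nonempty?; anySubset?; ⊆-refl; ⊥⊆; ∉⊥; x∈⁅x⁆; x∈⁅y⁆⇒x≡y; p⊆p∪q; q⊆p∪q;
         x∈p∪q⁻; ∪-comm; p─q⊆p; x∈p∧x≢y⇒x∈p-y; x∈p⇒p-x⊂p)
open import Data.Fin.Subset.Induction using (⊂-wellFounded)
open import Data.List as List using (List)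
open import Data.List.Membership.Propositional using () renaming (_∈_ to _∈ₗ_)
open import Data.List.Membership.Propositional.Properties
  using (∈-map⁺; ∈-++⁺ˡ; ∈-++⁺ʳ; ∈-filter⁺; ∈-filter⁻; ∈-lookup)
open import Data.List.Relation.Unary.Any as Any using (here)
open import Data.List.Relation.Unary.Any.Properties using (lookup-index)
open import Data.Product as Product using (∃; ∃₂; _×_; _,_; proj₁; proj₂)
open import Data.Vec using ([]; _∷_; there; lookup; tabulate)
import Data.Vec.Functional as Vector
open import Data.Vec.Properties using ([]=⇒lookup; lookup⇒[]=; lookup∘tabulate)
open import Function using (_⇔_; mk⇔; _∘_; case_of_)
open import Function.Bundles using (module Equivalence)
open import Function.Construct.Composition using (_⇔-∘_)
open import Function.Construct.Symmetry using (⇔-sym)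
open import Function.Definitions using (Injective)
open import Induction.WellFounded using (Acc; acc)
open import Relation.Binary.Definitions using (tri<; tri≈; tri>)
open import Relation.Binary.PropositionalEquality
  using (_≡_; _≢_; refl; sym; trans; cong; subst)
open import Relation.Nullary using (¬_; Dec; yes; no; does)
open import Relation.Nullary.Decidable as Dec
  using (map′; ¬?; _×-dec_; _⊎-dec_; _→-dec_; decidable-stable; from-yes)
open import Relation.Unary using (Decidable)

open Equivalence using (to; from)

private variable
  k m n : ℕ
  X Y F : Subset n
  a b u v x y p : Fin n

x∉p-x : ∀ (X : Subset n) x → x ∉ X - x
x∉p-x (_ ∷ X) zero ()
x∉p-x (_ ∷ X) (suc x) (there x∈) = x∉p-x X x x∈

x∈p-y⇒x∈p : x ∈ X - y → x ∈ X
x∈p-y⇒x∈p {X = X} {y = y} = p─q⊆p X ⁅ y ⁆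

x∈p-y⇒x≢y : x ∈ X - y → x ≢ y
x∈p-y⇒x≢y {X = X} x∈ refl = x∉p-x X _ x∈

x∈p∪⁅y⁆⁻ : x ∈ X ∪ ⁅ y ⁆ → x ∈ X ⊎ x ≡ y
x∈p∪⁅y⁆⁻ {X = X} {y = y} = Sum.map₂ (x∈⁅y⁆⇒x≡y y) ∘ x∈p∪q⁻ X ⁅ y ⁆

y∈p∪⁅y⁆ : y ∈ X ∪ ⁅ y ⁆
y∈p∪⁅y⁆ {y = y} {X = X} = q⊆p∪q X ⁅ y ⁆ (x∈⁅x⁆ y)

p⊆q⇒p-x⊆q-x : X ⊆ Y → X - x ⊆ Y - x
p⊆q⇒p-x⊆q-x X⊆Y w∈ = x∈p∧x≢y⇒x∈p-y (X⊆Y (x∈p-y⇒x∈p w∈)) (x∈p-y⇒x≢y w∈)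

p∪⁅x⁆⊆q : X ⊆ Y → x ∈ Y → X ∪ ⁅ x ⁆ ⊆ Y
p∪⁅x⁆⊆q X⊆Y x∈Y w∈ with x∈p∪⁅y⁆⁻ w∈
... | inj₁ w∈X = X⊆Y w∈X
... | inj₂ refl = x∈Y

p⊆p-x∪⁅x⁆ : X ⊆ (X - x) ∪ ⁅ x ⁆
p⊆p-x∪⁅x⁆ {x = x} {w} w∈X with w ≟ x
... | yes refl = y∈p∪⁅y⁆
... | no w≢x = p⊆p∪q ⁅ x ⁆ (x∈p∧x≢y⇒x∈p-y w∈X w≢x)

pair : Fin n → Fin n → Subset n
pair a b = ⁅ a ⁆ ∪ ⁅ b ⁆

a∈pair : a ∈ pair a b
a∈pair {a = a} {b = b} = p⊆p∪q ⁅ b ⁆ (x∈⁅x⁆ a)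

b∈pair : b ∈ pair a b
b∈pair = y∈p∪⁅y⁆

x∈pair⁻ : x ∈ pair a b → x ≡ a ⊎ x ≡ b
x∈pair⁻ {a = a} {b = b} = Sum.map (x∈⁅y⁆⇒x≡y a) (x∈⁅y⁆⇒x≡y b) ∘ x∈p∪q⁻ ⁅ a ⁆ ⁅ b ⁆

pair⊆ : a ∈ X → b ∈ X → pair a b ⊆ X
pair⊆ {a = a} a∈X = p∪⁅x⁆⊆q λ w∈ → subst (_∈ _) (sym (x∈⁅y⁆⇒x≡y a w∈)) a∈X

select : {P : Fin n → Set} → Decidable P → Subset n
select P? = tabulate (does ∘ P?)

∈-select : {P : Fin n → Set} {P? : Decidable P} → x ∈ select P? ⇔ P x
∈-select {x = x} {P = P} {P? = P?} = mk⇔ selected λ Px →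
  lookup⇒[]= x _ (trans (lookup∘tabulate _ x) (Dec.dec-true (P? x) Px))
  where
  selected : x ∈ select P? → P x
  selected x∈ with P? x | trans (sym (lookup∘tabulate (does ∘ P?) x)) ([]=⇒lookup x∈)
  ... | yes Px | _ = Px

not-lookup≡true⇔∉ : not (lookup X x) ≡ true ⇔ x ∉ X
not-lookup≡true⇔∉ {X = X} {x = x} = mk⇔
  (λ e x∈X → case trans (sym e) (cong not ([]=⇒lookup x∈X)) of λ ())
  (λ x∉X → cong not (¬-not (x∉X ∘ lookup⇒[]= x X)))

not-lookup≡false⇔∈ : not (lookup X x) ≡ false ⇔ x ∈ X
not-lookup≡false⇔∈ {X = X} {x = x} =
  mk⇔ (lookup⇒[]= x X ∘ not-injective) (cong not ∘ []=⇒lookup)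

allSubsets : ∀ n → List (Subset n)
allSubsets zero = List.[ [] ]
allSubsets (suc n) =
  List.map (inside ∷_) (allSubsets n) List.++ List.map (outside ∷_) (allSubsets n)

∈-allSubsets : ∀ (X : Subset n) → X ∈ₗ allSubsets n
∈-allSubsets [] = here refl
∈-allSubsets (inside ∷ X) = ∈-++⁺ˡ (∈-map⁺ (inside ∷_) (∈-allSubsets X))
∈-allSubsets {suc n} (outside ∷ X) =
  ∈-++⁺ʳ (List.map (inside ∷_) (allSubsets n)) (∈-map⁺ (outside ∷_) (∈-allSubsets X))

allSubsets? : {P : Subset n → Set} → Decidable P → Dec (∀ X → P X)
allSubsets? P? = map′ (λ ∄¬P X → decidable-stable (P? X) (λ ¬PX → ∄¬P (X , ¬PX)))
                      (λ ∀P (X , ¬PX) → ¬PX (∀P X))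
                      (¬? (anySubset? (¬? ∘ P?)))

Isolates : BoolMatrix m n → Fin m → Fin n → Subset n → Set
Isolates M r x Y = M r x ≡ true × (∀ y → y ∈ Y → M r y ≡ false)

isolates? : ∀ (M : BoolMatrix m n) r x Y → Dec (Isolates M r x Y)
isolates? M r x Y = M r x ≟ᵇ true ×-dec all? λ y → y ∈? Y →-dec M r y ≟ᵇ false

-- Independence read off one column at a time: x and r are the first column and row of the
-- triangular submatrix.
data Peelable (M : BoolMatrix m n) : Subset n → Set where
  empty : Empty X → Peelable M X
  peel  : x ∈ X → (r : Fin m) → Isolates M r x (X - x) → Peelable M (X - x) → Peelable M X

module _ {M : BoolMatrix m n} where

  peelable-downClosed : Y ⊆ X → Peelable M X → Peelable M Y
  peelable-downClosed Y⊆X (empty X-empty) = empty λ (y , y∈Y) → X-empty (y , Y⊆X y∈Y)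
  peelable-downClosed {Y = Y} {X = X} Y⊆X (peel {x = x} x∈X r (Mrx , Mr-rest) P) with x ∈? Y
  ... | yes x∈Y = peel x∈Y r (Mrx , λ y y∈ → Mr-rest y (Y-x⊆X-x y∈)) (peelable-downClosed Y-x⊆X-x P)
    where
    Y-x⊆X-x : Y - x ⊆ X - x
    Y-x⊆X-x = p⊆q⇒p-x⊆q-x Y⊆X
  ... | no x∉Y = peelable-downClosed (λ y∈Y → x∈p∧x≢y⇒x∈p-y (Y⊆X y∈Y) λ { refl → x∉Y y∈Y }) P

  peelable? : ∀ X → Dec (Peelable M X)
  peelable? X = go X (⊂-wellFounded X)
    where
    go : ∀ X → Acc _⊂_ X → Dec (Peelable M X)
    go X (acc rs) with nonempty? X
    ... | no X-empty = yes (empty X-empty)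
    ... | yes X-nonempty =
      map′ (λ (_ , x∈X , (r , iso) , P) → peel x∈X r iso P) first-peel (any? peelAt?)
      where
      PeelAt : Fin n → Set
      PeelAt x = x ∈ X × (∃ λ r → Isolates M r x (X - x)) × Peelable M (X - x)

      peelAt? : ∀ x → Dec (PeelAt x)
      peelAt? x with x ∈? X
      ... | no x∉X = no (x∉X ∘ proj₁)
      ... | yes x∈X = map′ (x∈X ,_) proj₂
        (any? (λ r → isolates? M r x (X - x)) ×-dec go (X - x) (rs (x∈p⇒p-x⊂p x∈X)))

      first-peel : Peelable M X → ∃ PeelAt
      first-peel (empty X-empty) = ⊥-elim (X-empty X-nonempty)
      first-peel (peel x∈X r iso P) = _ , x∈X , (r , iso) , P

lowerUnitriangular⇒rowsDiffer : ∀ (M : BoolMatrix m n) {r : Fin k → Fin m} {c} →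
                                LowerUnitriangularAt M r c → ∀ {i j} → i < j → r i ≢ r j
lowerUnitriangular⇒rowsDiffer M {c = c} (diag , above) {i} {j} i<j ri≡rj =
  case trans (sym (diag j)) (trans (cong (λ s → M s (c j)) (sym ri≡rj)) (above i j i<j)) of λ ()

lowerUnitriangular⇒injective : ∀ (M : BoolMatrix m n) {r : Fin k → Fin m} {c} →
                               LowerUnitriangularAt M r c → Injective _≡_ _≡_ r
lowerUnitriangular⇒injective M lut {i} {j} ri≡rj with <-cmp i j
... | tri< i<j _ _ = ⊥-elim (lowerUnitriangular⇒rowsDiffer M lut i<j ri≡rj)
... | tri≈ _ i≡j _ = i≡j
... | tri> _ _ j<i = ⊥-elim (lowerUnitriangular⇒rowsDiffer M lut j<i (sym ri≡rj))

∷-injective : {c : Fin k → Fin n} → (∀ j → c j ≢ x) → Injective _≡_ _≡_ c →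
              Injective _≡_ _≡_ (x Vector.∷ c)
∷-injective c≢x c-inj {zero} {zero} _ = refl
∷-injective c≢x c-inj {zero} {suc j} x≡cj = ⊥-elim (c≢x j (sym x≡cj))
∷-injective c≢x c-inj {suc i} {zero} ci≡x = ⊥-elim (c≢x i ci≡x)
∷-injective c≢x c-inj {suc i} {suc j} ci≡cj = cong suc (c-inj ci≡cj)

module _ {M : BoolMatrix m n} where

  enumeration⇒peelable : (r : Fin k → Fin m) (c : Fin k → Fin n) → Injective _≡_ _≡_ c →
                         LowerUnitriangularAt M r c → (∀ v → v ∈ X ⇔ ∃ λ j → c j ≡ v) →
                         Peelable M X
  enumeration⇒peelable {k = zero} r c _ _ X⇔ = empty λ (x , x∈X) → case to (X⇔ x) x∈X of λ ()
  enumeration⇒peelable {k = suc k} {X = X} r c c-inj (diag , above) X⇔ =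
    peel (from (X⇔ (c zero)) (zero , refl)) (r zero) (diag zero , isolated)
      (enumeration⇒peelable (r ∘ suc) (c ∘ suc) (suc-injective ∘ c-inj)
        ((diag ∘ suc) , λ i j i<j → above (suc i) (suc j) (s≤s i<j)) X-c₀⇔)
    where
    later : ∀ {v} → v ∈ X - c zero → ∃ λ j → c (suc j) ≡ v
    later v∈ with to (X⇔ _) (x∈p-y⇒x∈p v∈)
    ... | zero , refl = ⊥-elim (x∈p-y⇒x≢y v∈ refl)
    ... | suc j , c₁₊ⱼ≡v = j , c₁₊ⱼ≡v

    isolated : ∀ v → v ∈ X - c zero → M (r zero) v ≡ false
    isolated v v∈ with later v∈
    ... | j , refl = above zero (suc j) (s≤s z≤n)

    X-c₀⇔ : ∀ v → v ∈ X - c zero ⇔ ∃ λ j → c (suc j) ≡ v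
    X-c₀⇔ v = mk⇔ later λ (j , c₁₊ⱼ≡v) →
      subst (_∈ X - c zero) c₁₊ⱼ≡v
        (x∈p∧x≢y⇒x∈p-y (from (X⇔ _) (suc j , refl)) (λ e → case c-inj e of λ ()))

  peelable⇒independent : Peelable M X → Independent M X
  peelable⇒independent (empty X-empty) =
    0 , (λ ()) , (λ ()) , (λ { {()} }) , (λ { {()} }) ,
    (λ v → mk⇔ (λ v∈X → ⊥-elim (X-empty (v , v∈X))) λ ()) , (λ ()) , λ ()
  peelable⇒independent {X = X} (peel {x = x} x∈X r₀ (M₀x , M₀-rest) P)
    with peelable⇒independent P
  ... | k , r , c , _ , c-inj , X-x⇔ , (diag , above) =
    suc k , r′ , c′ , lowerUnitriangular⇒injective M lut ,
    ∷-injective (λ j → x∈p-y⇒x≢y (c∈ j)) c-inj , X⇔ , lut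
    where
    r′ : Fin (suc k) → Fin _
    r′ = r₀ Vector.∷ r
    c′ : Fin (suc k) → Fin _
    c′ = x Vector.∷ c

    c∈ : ∀ j → c j ∈ X - x
    c∈ j = from (X-x⇔ _) (j , refl)

    lut : LowerUnitriangularAt M r′ c′
    lut = diag′ , above′
      where
      diag′ : ∀ i → M (r′ i) (c′ i) ≡ true
      diag′ zero = M₀x
      diag′ (suc i) = diag i
      above′ : ∀ i j → i < j → M (r′ i) (c′ j) ≡ false
      above′ zero (suc j) _ = M₀-rest (c j) (c∈ j)
      above′ (suc i) (suc j) (s≤s i<j) = above i j i<j

    X⇔ : ∀ v → v ∈ X ⇔ ∃ λ j → c′ j ≡ v
    X⇔ v = mk⇔ enumerated listed
      where
      enumerated : v ∈ X → ∃ λ j → c′ j ≡ v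
      enumerated v∈X with v ≟ x
      ... | yes refl = zero , refl
      ... | no v≢x with to (X-x⇔ v) (x∈p∧x≢y⇒x∈p-y v∈X v≢x)
      ...   | j , cⱼ≡v = suc j , cⱼ≡v
      listed : (∃ λ j → c′ j ≡ v) → v ∈ X
      listed (zero , refl) = x∈X
      listed (suc j , refl) = x∈p-y⇒x∈p (c∈ j)

  independent⇔peelable : Independent M X ⇔ Peelable M X
  independent⇔peelable = mk⇔
    (λ (_ , r , c , _ , c-inj , X⇔ , lut) → enumeration⇒peelable r c c-inj lut X⇔)
    peelable⇒independent

PointReplacement : (Subset n → Set) → Set
PointReplacement G =
  ∀ {X p} → G X → p ∉ X → Nonempty X → ∃ λ x → x ∈ X × G ((X - x) ∪ ⁅ p ⁆)

pointReplacement-resp : {G G′ : Subset n → Set} → (∀ X → G X ⇔ G′ X) →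
                        PointReplacement G → PointReplacement G′
pointReplacement-resp G⇔G′ pr G′X p∉X X-nonempty =
  Product.map₂ (Product.map₂ (to (G⇔G′ _))) (pr (from (G⇔G′ _) G′X) p∉X X-nonempty)

peelable-pointReplacement : {M : BoolMatrix m n} → (∀ u → Peelable M ⁅ u ⁆) →
                            PointReplacement (Peelable M)
peelable-pointReplacement _ (empty X-empty) _ X-nonempty = ⊥-elim (X-empty X-nonempty)
peelable-pointReplacement {M = M} singletons {X = Y} {p = d}
                          (peel {x = v} v∈Y r (Mrv , Mr-rest) P) d∉Y _
  with M r d in Mrd | nonempty? (Y - v)
... | true | _ =
  v , v∈Y , peel y∈p∪⁅y⁆ r (Mrd , λ w w∈ → Mr-rest w (shrink w∈)) (peelable-downClosed shrink P)
  where
  shrink : (Y - v) ∪ ⁅ d ⁆ - d ⊆ Y - v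
  shrink w∈ with x∈p∪⁅y⁆⁻ (x∈p-y⇒x∈p w∈)
  ... | inj₁ w∈Y-v = w∈Y-v
  ... | inj₂ refl = ⊥-elim (x∈p-y⇒x≢y w∈ refl)
... | false | no Y-v-empty =
  v , v∈Y ,
  peelable-downClosed (p∪⁅x⁆⊆q (λ w∈ → ⊥-elim (Y-v-empty (_ , w∈))) (x∈⁅x⁆ d)) (singletons d)
... | false | yes Y-v-nonempty
  with peelable-pointReplacement singletons P (d∉Y ∘ x∈p-y⇒x∈p) Y-v-nonempty
...   | y , y∈Y-v , Q =
  y , x∈p-y⇒x∈p y∈Y-v , peel v∈ r (Mrv , isolated) (peelable-downClosed moved Q)
  where
  v∈ : v ∈ (Y - y) ∪ ⁅ d ⁆
  v∈ = p⊆p∪q ⁅ d ⁆ (x∈p∧x≢y⇒x∈p-y v∈Y (x∈p-y⇒x≢y y∈Y-v ∘ sym))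

  moved : (Y - y) ∪ ⁅ d ⁆ - v ⊆ (Y - v - y) ∪ ⁅ d ⁆
  moved w∈ with x∈p∪⁅y⁆⁻ (x∈p-y⇒x∈p w∈)
  ... | inj₂ refl = y∈p∪⁅y⁆
  ... | inj₁ w∈Y-y = p⊆p∪q ⁅ d ⁆
    (x∈p∧x≢y⇒x∈p-y (x∈p∧x≢y⇒x∈p-y (x∈p-y⇒x∈p w∈Y-y) (x∈p-y⇒x≢y w∈)) (x∈p-y⇒x≢y w∈Y-y))

  isolated : ∀ w → w ∈ (Y - y) ∪ ⁅ d ⁆ - v → M r w ≡ false
  isolated w w∈ with x∈p∪⁅y⁆⁻ (moved w∈)
  ... | inj₁ w∈Y-v-y = Mr-rest w (x∈p-y⇒x∈p w∈Y-v-y)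
  ... | inj₂ refl = Mrd

Flat : (Subset n → Set) → Subset n → Set
Flat G F = ∀ I p → G I → I ⊆ F → p ∉ F → G (I ∪ ⁅ p ⁆)

flat? : {G : Subset n → Set} → Decidable G → Decidable (Flat G)
flat? G? F = allSubsets? λ I → all? λ p →
  G? I →-dec I ⊆? F →-dec ¬? (p ∈? F) →-dec G? (I ∪ ⁅ p ⁆)

FlatSeparated : (Subset n → Set) → Subset n → Set
FlatSeparated G X = ∃ λ x → x ∈ X × ∃ λ F → Flat G F × X - x ⊆ F × x ∉ F

module _ {G : Subset n → Set} (complex : IsSimplicialComplex G) (G? : Decidable G) where
  open IsSimplicialComplex complex

  flats : List (Subset n)
  flats = List.filter (flat? G?) (allSubsets n)

  flatMatrix : BoolMatrix (List.length flats) n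
  flatMatrix i = not ∘ lookup (List.lookup flats i)

  lookup-flats : ∀ i → Flat G (List.lookup flats i)
  lookup-flats i = proj₂ (∈-filter⁻ (flat? G?) {xs = allSubsets n} (∈-lookup i))

  flat⇒∈flats : Flat G F → ∃ λ i → List.lookup flats i ≡ F
  flat⇒∈flats {F = F} F-flat = Any.index F∈ , sym (lookup-index F∈)
    where
    F∈ : F ∈ₗ flats
    F∈ = ∈-filter⁺ (flat? G?) (∈-allSubsets F) F-flat

  peelable⇒face : G ⊥ → Peelable flatMatrix X → G X
  peelable⇒face G⊥ (empty X-empty) = downClosed ⊥ _ (λ x∈X → ⊥-elim (X-empty (_ , x∈X))) G⊥
  peelable⇒face {X = X} G⊥ (peel {x = x} x∈X i (Mix , Mi-rest) P) =
    downClosed _ X p⊆p-x∪⁅x⁆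
      (lookup-flats i (X - x) x (peelable⇒face G⊥ P)
        (λ {w} w∈ → to not-lookup≡false⇔∈ (Mi-rest w w∈)) (to not-lookup≡true⇔∉ Mix))

  face⇒peelable : (∀ {X} → G X → Nonempty X → FlatSeparated G X) →
                  G X → Peelable flatMatrix X
  face⇒peelable separated = go _ (⊂-wellFounded _)
    where
    go : ∀ X → Acc _⊂_ X → G X → Peelable flatMatrix X
    go X (acc rs) GX with nonempty? X
    ... | no X-empty = empty X-empty
    ... | yes X-nonempty with separated GX X-nonempty
    ...   | x , x∈X , F , F-flat , X-x⊆F , x∉F with flat⇒∈flats F-flat
    ...     | i , refl =
      peel x∈X i (from not-lookup≡true⇔∉ x∉F , λ w w∈ → from not-lookup≡false⇔∈ (X-x⊆F w∈))
        (go (X - x) (rs (x∈p⇒p-x⊂p x∈X)) (downClosed X (X - x) x∈p-y⇒x∈p GX))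

  flatRepresentation : G ⊥ → (∀ {X} → G X → Nonempty X → FlatSeparated G X) →
                       BooleanRepresentable G
  flatRepresentation G⊥ separated = List.length flats , flatMatrix , λ X →
    ⇔-sym independent⇔peelable ⇔-∘ mk⇔ (face⇒peelable separated) (peelable⇒face G⊥)

module _ {G : Subset n → Set} (complex : IsSimplicialComplex G) where
  open IsSimplicialComplex complex

  flat-if-extensions : (∀ p → p ∉ F → G (F ∪ ⁅ p ⁆)) → Flat G F
  flat-if-extensions extend I p _ I⊆F p∉F =
    downClosed _ _ (p∪⁅x⁆⊆q (λ w∈I → p⊆p∪q ⁅ p ⁆ (I⊆F w∈I)) y∈p∪⁅y⁆) (extend p p∉F)

  ⊥-flat : Flat G ⊥
  ⊥-flat = flat-if-extensions λ p _ → downClosed ⁅ p ⁆ _ (p∪⁅x⁆⊆q ⊥⊆ (x∈⁅x⁆ p)) (singletons p)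

  p-x-flat : G X → (∀ d → d ∉ X → G ((X - x) ∪ ⁅ d ⁆)) → Flat G (X - x)
  p-x-flat {X = X} GX extend = flat-if-extensions λ p _ → case p ∈? X of λ where
    (yes p∈X) → downClosed X _ (p∪⁅x⁆⊆q x∈p-y⇒x∈p p∈X) GX
    (no p∉X) → extend p p∉X

  pair-sym : G (pair a b) → G (pair b a)
  pair-sym {a = a} {b = b} = subst G (∪-comm ⁅ a ⁆ ⁅ b ⁆)

  vertex-flatSeparated : v ∈ X → (∀ w → w ∈ X → w ≡ v) → FlatSeparated G X
  vertex-flatSeparated v∈X only-v =
    _ , v∈X , ⊥ , ⊥-flat , (λ w∈ → ⊥-elim (x∈p-y⇒x≢y w∈ (only-v _ (x∈p-y⇒x∈p w∈)))) , ∉⊥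

  module _ (pr : PointReplacement G) where

    almostFull-replacement : G X → Nonempty X → (∀ d d′ → d ∉ X → d′ ∉ X → d ≡ d′) →
                         ∃ λ y → y ∈ X × ∀ d → d ∉ X → G ((X - y) ∪ ⁅ d ⁆)
    almostFull-replacement {X = X} GX (v , v∈X) outside-unique
      with any? (λ d → ¬? (d ∈? X))
    ... | no noutside-unique = v , v∈X , λ d d∉X → ⊥-elim (noutside-unique (d , d∉X))
    ... | yes (d , d∉X) with pr GX d∉X (v , v∈X)
    ...   | y , y∈X , G-replaced =
      y , y∈X , λ d′ d′∉X →
        subst (λ e → G ((X - y) ∪ ⁅ e ⁆)) (outside-unique d d′ d∉X d′∉X) G-replaced

    almostFull-flatSeparated : G X → Nonempty X → (∀ d d′ → d ∉ X → d′ ∉ X → d ≡ d′) →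
                           FlatSeparated G X
    almostFull-flatSeparated {X = X} GX X-nonempty outside-unique
      with almostFull-replacement GX X-nonempty outside-unique
    ... | y , y∈X , extend = y , y∈X , X - y , p-x-flat GX extend , ⊆-refl , x∉p-x X y

    pair-exchange : a ≢ b → G (pair a b) → u ≢ a → u ≢ b → G (pair a u) ⊎ G (pair b u)
    pair-exchange {a = a} {b = b} {u = u} a≢b Gab u≢a u≢b
      with pr Gab (λ u∈ → [ u≢a , u≢b ]′ (x∈pair⁻ u∈)) (a , a∈pair)
    ... | y , y∈ , G-replaced with x∈pair⁻ y∈
    ...   | inj₁ refl = inj₂ (downClosed _ _ (kept b∈pair (a≢b ∘ sym)) G-replaced)
      where
      kept : ∀ {w} → w ∈ pair a b → w ≢ a → pair w u ⊆ (pair a b - a) ∪ ⁅ u ⁆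
      kept w∈ w≢a = pair⊆ (p⊆p∪q ⁅ u ⁆ (x∈p∧x≢y⇒x∈p-y w∈ w≢a)) y∈p∪⁅y⁆
    ...   | inj₂ refl = inj₁ (downClosed _ _ (kept a∈pair a≢b) G-replaced)
      where
      kept : ∀ {w} → w ∈ pair a b → w ≢ b → pair w u ⊆ (pair a b - b) ∪ ⁅ u ⁆
      kept w∈ w≢b = pair⊆ (p⊆p∪q ⁅ u ⁆ (x∈p∧x≢y⇒x∈p-y w∈ w≢b)) y∈p∪⁅y⁆

    module _ (G? : Decidable G) (b : Fin n) where

      nonNeighbour? : Decidable λ u → u ≡ b ⊎ ¬ G (pair u b)
      nonNeighbour? u = u ≟ b ⊎-dec ¬? (G? (pair u b))

      nonNeighbours : Subset n
      nonNeighbours = select nonNeighbour?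

      ∈nonNeighbours : u ∈ nonNeighbours ⇔ (u ≡ b ⊎ ¬ G (pair u b))
      ∈nonNeighbours = ∈-select {P? = nonNeighbour?}

      nonadjacent⇒≢ : ¬ G (pair u b) → u ≢ b
      nonadjacent⇒≢ {u = u} ¬Gub refl =
        ¬Gub (downClosed ⁅ u ⁆ _ (pair⊆ (x∈⁅x⁆ u) (x∈⁅x⁆ u)) (singletons u))

      ∉nonNeighbours : p ∉ nonNeighbours → p ≢ b × G (pair p b)
      ∉nonNeighbours p∉ =
        p∉ ∘ from ∈nonNeighbours ∘ inj₁ , decidable-stable (G? _) (p∉ ∘ from ∈nonNeighbours ∘ inj₂)

      nonNeighbours-independent : u ∈ nonNeighbours → v ∈ nonNeighbours → u ≢ v →
                                  ¬ G (pair u v)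
      nonNeighbours-independent u∈ v∈ u≢v Guv with to ∈nonNeighbours u∈ | to ∈nonNeighbours v∈
      ... | inj₁ refl | inj₁ refl = u≢v refl
      ... | inj₁ refl | inj₂ ¬Gvb = ¬Gvb (pair-sym Guv)
      ... | inj₂ ¬Gub | inj₁ refl = ¬Gub Guv
      ... | inj₂ ¬Gub | inj₂ ¬Gvb =
        [ ¬Gub , ¬Gvb ]′
          (pair-exchange u≢v Guv (nonadjacent⇒≢ ¬Gub ∘ sym) (nonadjacent⇒≢ ¬Gvb ∘ sym))

      nonNeighbours-adjacent : u ∈ nonNeighbours → p ∉ nonNeighbours → G (pair u p)
      nonNeighbours-adjacent {u = u} {p = p} u∈ p∉ with ∉nonNeighbours p∉ | to ∈nonNeighbours u∈
      ... | _ , Gpb | inj₁ refl = pair-sym Gpb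
      ... | p≢b , Gpb | inj₂ ¬Gub =
        [ pair-sym , (λ Gbu → ⊥-elim (¬Gub (pair-sym Gbu))) ]′
          (pair-exchange p≢b Gpb u≢p (nonadjacent⇒≢ ¬Gub))
        where
        u≢p : u ≢ p
        u≢p refl = p∉ u∈

      nonNeighbours-flat : Flat G nonNeighbours
      nonNeighbours-flat I p GI I⊆N p∉N with nonempty? I
      ... | no I-empty =
        downClosed ⁅ p ⁆ _ (p∪⁅x⁆⊆q (λ w∈ → ⊥-elim (I-empty (_ , w∈))) (x∈⁅x⁆ p)) (singletons p)
      ... | yes (u , u∈I) =
        downClosed (pair u p) _ (p∪⁅x⁆⊆q (λ w∈ → p⊆p∪q ⁅ p ⁆ (I⊆⁅u⁆ w∈)) y∈p∪⁅y⁆)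
          (nonNeighbours-adjacent (I⊆N u∈I) p∉N)
        where
        I⊆⁅u⁆ : I ⊆ ⁅ u ⁆
        I⊆⁅u⁆ {w} w∈I with w ≟ u
        ... | yes refl = x∈⁅x⁆ w
        ... | no w≢u = ⊥-elim
          (nonNeighbours-independent (I⊆N w∈I) (I⊆N u∈I) w≢u (downClosed I _ (pair⊆ w∈I u∈I) GI))

    pair-flatSeparated : Decidable G → a ≢ b → a ∈ X → b ∈ X →
                         (∀ w → w ∈ X → w ≡ a ⊎ w ≡ b) → G X → FlatSeparated G X
    pair-flatSeparated {a = a} {b = b} {X = X} G? a≢b a∈X b∈X only-ab GX =
      a , a∈X , nonNeighbours G? b , nonNeighbours-flat G? b , X-a⊆ , a∉
      where
      X-a⊆ : X - a ⊆ nonNeighbours G? b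
      X-a⊆ w∈ with only-ab _ (x∈p-y⇒x∈p w∈)
      ... | inj₁ refl = ⊥-elim (x∈p-y⇒x≢y w∈ refl)
      ... | inj₂ refl = from (∈nonNeighbours G? b) (inj₁ refl)
      a∉ : a ∉ nonNeighbours G? b
      a∉ a∈ = [ a≢b , (λ ¬Gab → ¬Gab (downClosed X _ (pair⊆ a∈X b∈X) GX)) ]′
                (to (∈nonNeighbours G? b) a∈)

SmallShape : Subset n → Set
SmallShape X = (∃ λ v → v ∈ X × ∀ w → w ∈ X → w ≡ v)
             ⊎ (∃₂ λ a b → a ≢ b × a ∈ X × b ∈ X × ∀ w → w ∈ X → w ≡ a ⊎ w ≡ b)
             ⊎ (∀ d d′ → d ∉ X → d′ ∉ X → d ≡ d′)

smallShape? : Decidable (SmallShape {n})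
smallShape? X =
  any? (λ v → v ∈? X ×-dec all? λ w → w ∈? X →-dec w ≟ v)
  ⊎-dec any? (λ a → any? λ b → ¬? (a ≟ b) ×-dec a ∈? X ×-dec b ∈? X ×-dec
                                  all? λ w → w ∈? X →-dec (w ≟ a ⊎-dec w ≟ b))
  ⊎-dec all? (λ d → all? λ d′ → ¬? (d ∈? X) →-dec ¬? (d′ ∈? X) →-dec d ≟ d′)

nonempty⇒smallShape? : ∀ n → Dec (∀ (X : Subset n) → Nonempty X → SmallShape X)
nonempty⇒smallShape? n = allSubsets? λ X → nonempty? X →-dec smallShape? X

nonempty⇒smallShape : n ≤ 4 → ∀ (X : Subset n) → Nonempty X → SmallShape X
nonempty⇒smallShape {0} _ = from-yes (nonempty⇒smallShape? 0)
nonempty⇒smallShape {1} _ = from-yes (nonempty⇒smallShape? 1)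
nonempty⇒smallShape {2} _ = from-yes (nonempty⇒smallShape? 2)
nonempty⇒smallShape {3} _ = from-yes (nonempty⇒smallShape? 3)
nonempty⇒smallShape {4} _ = from-yes (nonempty⇒smallShape? 4)
nonempty⇒smallShape {suc (suc (suc (suc (suc _))))} (s≤s (s≤s (s≤s (s≤s ()))))

pointReplacement⇒flatSeparated : {G : Subset n → Set} → n ≤ 4 → IsSimplicialComplex G →
                                 Decidable G → PointReplacement G →
                                 G X → Nonempty X → FlatSeparated G X
pointReplacement⇒flatSeparated {X = X} n≤4 complex G? pr GX X-nonempty
  with nonempty⇒smallShape n≤4 X X-nonempty
... | inj₁ (_ , v∈X , only-v) = vertex-flatSeparated complex v∈X only-v
... | inj₂ (inj₁ (_ , _ , a≢b , a∈X , b∈X , only-ab)) =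
  pair-flatSeparated complex pr G? a≢b a∈X b∈X only-ab GX
... | inj₂ (inj₂ outside-unique) = almostFull-flatSeparated complex pr GX X-nonempty outside-unique

module _ {H : Subset n → Set} where

  representable⇒decidable : BooleanRepresentable H → Decidable H
  representable⇒decidable (_ , M , H⇔) X =
    Dec.map (⇔-sym (independent⇔peelable {M = M} ⇔-∘ H⇔ X)) (peelable? X)

  representable⇒pointReplacement : IsSimplicialComplex H → BooleanRepresentable H →
                                   PointReplacement H
  representable⇒pointReplacement complex (_ , M , H⇔) =
    pointReplacement-resp (⇔-sym ∘ H⇔P)
      (peelable-pointReplacement (λ u → to (H⇔P ⁅ u ⁆) (singletons u)))
    where
    open IsSimplicialComplex complex
    H⇔P : ∀ X → H X ⇔ Peelable M X
    H⇔P X = independent⇔peelable ⇔-∘ H⇔ X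

module _ {H H′ : Subset n → Set} where

  ∪-complex : IsSimplicialComplex H → IsSimplicialComplex H′ →
              IsSimplicialComplex (λ X → H X ⊎ H′ X)
  ∪-complex complex complex′ = record
    { singletons = inj₁ ∘ singletons complex
    ; downClosed = λ X Y Y⊆X →
        Sum.map (downClosed complex X Y Y⊆X) (downClosed complex′ X Y Y⊆X)
    }
    where open IsSimplicialComplex

  ∪-pointReplacement : PointReplacement H → PointReplacement H′ →
                       PointReplacement (λ X → H X ⊎ H′ X)
  ∪-pointReplacement pr _ (inj₁ HX) p∉X X-nonempty =
    Product.map₂ (Product.map₂ inj₁) (pr HX p∉X X-nonempty)
  ∪-pointReplacement _ pr′ (inj₂ H′X) p∉X X-nonempty =
    Product.map₂ (Product.map₂ inj₂) (pr′ H′X p∉X X-nonempty)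

proposition5p1 : ∀ (n : ℕ) → 1 ≤ n → n ≤ 4 → (H H′ : Subset n → Set) →
    IsSimplicialComplex H → IsSimplicialComplex H′ →
    BooleanRepresentable H → BooleanRepresentable H′ →
    BooleanRepresentable (λ X → H X ⊎ H′ X)
proposition5p1 n 1≤n n≤4 H H′ complex complex′ representable representable′ =
  flatRepresentation join-complex join? join-∅
    (pointReplacement⇒flatSeparated n≤4 join-complex join? join-pr)
  where
  join-complex : IsSimplicialComplex (λ X → H X ⊎ H′ X)
  join-complex = ∪-complex complex complex′

  join? : Decidable (λ X → H X ⊎ H′ X)
  join? X = representable⇒decidable representable X ⊎-dec representable⇒decidable representable′ X

  join-pr : PointReplacement (λ X → H X ⊎ H′ X)
  join-pr = ∪-pointReplacement (representable⇒pointReplacement complex representable)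
                               (representable⇒pointReplacement complex′ representable′)

  join-∅ : H ⊥ ⊎ H′ ⊥
  join-∅ = downClosed join-complex _ ⊥ ⊥⊆ (singletons join-complex (fromℕ< 1≤n))
    where open IsSimplicialComplex
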